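{- Let $\mathcal M=(E,\rho)$ be a $q$-matroid with projectivization matroid $P(\mathcal M)=(\mathbb PE,r)$, fix a non-degenerate symmetric bilinear form on $E$, and let $\langle e\rangle,\langle v\rangle\in\mathbb PE$ with $\langle e\rangle\oplus\langle v\rangle^\perp=E$. Let $\mathcal Q_{v^\perp}$ be the set of lines of $E$ not contained in $\langle v\rangle^\perp$ and $\mathcal Q_{v^\perp}^{*e}=\mathcal Q_{v^\perp}-\{\langle e\rangle\}$. Let $A\subsetneq\mathcal Q_{v^\perp}^{*e}$. Then: (a) for every $w\in\mathcal Q_{v^\perp}^{*e}-A$, $w$ is not a coloop of $P(\mathcal M)\setminus A$; (b) for every $w\in\mathcal Q_{v^\perp}^{*e}-A$ and every $z\in\mathcal Q_{v^\perp}-(A\cup\{w\})$, $z$ is not a coloop of $(P(\mathcal M)\setminus A)/w$; (c) for all distinct $w_1,w_2\in\mathcal Q_{v^\perp}-A$, the matroid $(P(\mathcal M)\setminus A)/\{w_1,w_2\}$ contains a loop; (d) $\langle e\rangle$ is a coloop of $P(\mathcal M)\setminus\mathcal Q_{v^\perp}^{*e}$ if and only if $\langle v\rangle$ is a coloop of $\mathcal M$.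
   Context: A $q$-matroid is a pair $(E,\rho)$ where $E$ is a finite-dimensional vector space over the finite field $\mathbb F_q$ and $\rho$ assigns to each subspace a nonnegative integer with $0\le\rho(U)\le\dim U$, monotonicity and submodularity. $\mathbb PE$ is the set of lines of $E$; $P(\mathcal M)=(\mathbb PE,r)$ with $r(S)=\rho(\langle S\rangle)$, $\langle S\rangle$ the span of the union of lines in $S$. $\perp$ is taken with respect to the fixed form. A line $\langle v\rangle$ is a coloop of $\mathcal M$ if $\rho(\langle v\rangle^\perp)=\rho(E)-1$ (it is a loop of the dual $q$-matroid $\rho^*(V)=\dim V-\rho(E)+\rho(V^\perp)$). An element $w$ of a matroid $(S,r)$ is a coloop if $r(S-\{w\})=r(S)-1$, and a loop if $r(\{w\})=0$. Matroid deletion $M\setminus A=(S-A,r|)$ and contraction $M/A=(S-A,r')$ with $r'(B)=r(B\cup A)-r(A)$. -}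

module Defs where

open import Level using (0ℓ)
open import Data.Nat using (ℕ; zero; suc; _≤_; _∸_) renaming (_+_ to _+ℕ_)
open import Data.Vec using (Vec; []; _∷_; zipWith; map; replicate; foldr)
open import Data.List using (List)
open import Data.List.Membership.Propositional using (_∈_)
open import Data.Product using (Σ; ∃; _×_; _,_)
open import Data.Sum using (_⊎_)
open import Data.Bool using (Bool)
open import Relation.Nullary using (¬_)
open import Relation.Binary.PropositionalEquality using (_≡_; _≢_)
open import Relation.Binary.Definitions using (DecidableEquality)
open import Algebra.Structures using (IsCommutativeRing)

record FiniteField : Set₁ where
  infixl 6 _+_
  infixl 7 _*_
  field
    Carrier : Set
    _+_ _*_ : Carrier → Carrier → Carrier
    -_      : Carrier → Carrier
    0# 1#   : Carrier
    isCommutativeRing : IsCommutativeRing _≡_ _+_ _*_ -_ 0# 1#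
    0≢1     : 0# ≢ 1#
    inverse : ∀ x → x ≢ 0# → Σ Carrier (λ y → x * y ≡ 1#)
    _≟_     : DecidableEquality Carrier
    elements : List Carrier
    complete : ∀ x → x ∈ elements

module Space (𝔽 : FiniteField) (n : ℕ) where
  open FiniteField 𝔽 renaming (Carrier to F)

  V : Set
  V = Vec F n

  0v : V
  0v = replicate n 0#

  _⊕_ : V → V → V
  _⊕_ = zipWith _+_

  _·_ : F → V → V
  c · x = map (c *_) x

  VPred : Set₁
  VPred = V → Set

  record IsSubspace (U : VPred) : Set where
    field
      0∈       : U 0v
      ⊕-closed : ∀ {x y} → U x → U y → U (x ⊕ y)
      ·-closed : ∀ c {x} → U x → U (c · x)

  _⊆_ : VPred → VPred → Set
  P ⊆ Q = ∀ x → P x → Q x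

  lincomb : ∀ {d} → Vec F d → Vec V d → V
  lincomb cs vs = foldr (λ _ → V) _⊕_ 0v (zipWith _·_ cs vs)

  HasDim : VPred → ℕ → Set
  HasDim U d = Σ (Vec V d) λ bs →
      (∀ cs → lincomb cs bs ≡ 0v → cs ≡ replicate d 0#)
    × (∀ x → U x → Σ (Vec F d) λ cs → x ≡ lincomb cs bs)
    × (∀ cs → U (lincomb cs bs))

  Eₚ : VPred
  Eₚ _ = Data.Unit.⊤
    where import Data.Unit

  _∩_ : VPred → VPred → VPred
  (U ∩ W) x = U x × W x

  data SpanP (S : VPred) : VPred where
    span-0 : SpanP S 0v
    span-step : ∀ c {w x} → S w → SpanP S x → SpanP S ((c · w) ⊕ x)

  data _+ₚ_ (U W : VPred) : VPred where
    sum : ∀ {u w} → U u → W w → (U +ₚ W) (u ⊕ w)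

  -- A q-matroid: ρ is a function on subspaces of E (we take it as a function on
  -- predicates; all axioms only constrain its values on subspaces).
  record QMatroid : Set₁ where
    field
      ρ        : VPred → ℕ
      ρ-cong   : ∀ U W → IsSubspace U → IsSubspace W → U ⊆ W → W ⊆ U → ρ U ≡ ρ W
      ρ-dim    : ∀ U d → IsSubspace U → HasDim U d → ρ U ≤ d
      ρ-mono   : ∀ U W → IsSubspace U → IsSubspace W → U ⊆ W → ρ U ≤ ρ W
      ρ-submod : ∀ U W → IsSubspace U → IsSubspace W
               → ρ (U +ₚ W) +ℕ ρ (U ∩ W) ≤ ρ U +ℕ ρ W

  record SymBilinearForm : Set where
    field
      B       : V → V → F
      additiveˡ : ∀ x y z → B (x ⊕ y) z ≡ B x z + B y z
      homogˡ  : ∀ c x y → B (c · x) y ≡ c * B x y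
      symmetric : ∀ x y → B x y ≡ B y x
      nondegenerate : ∀ x → (∀ y → B x y ≡ 0#) → x ≡ 0v

  -- A line ⟨w⟩ (w ≠ 0) is represented by any nonzero w;
  -- a set of lines is a predicate on vectors (we only use ones that hold only
  -- at nonzero vectors and are invariant under nonzero scaling).

  LineSet : Set₁
  LineSet = VPred

  OnLine : V → V → Set
  OnLine w x = Σ F λ c → x ≡ c · w

  PE : LineSet
  PE x = x ≢ 0v

  ⟦_⟧ : V → LineSet
  ⟦ w ⟧ x = x ≢ 0v × OnLine w x

  SameLine : V → V → Set
  SameLine w u = OnLine w u

  _∖_ : LineSet → LineSet → LineSet
  (S ∖ T) x = S x × ¬ T x

  _∪_ : LineSet → LineSet → LineSet
  (S ∪ T) x = S x ⊎ T x

  ⟨_⟩ : LineSet → VPred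
  ⟨ S ⟩ = SpanP S

  perp : SymBilinearForm → V → VPred
  perp β v x = SymBilinearForm.B β x v ≡ 0#

  Q : SymBilinearForm → V → LineSet
  Q β v x = x ≢ 0v × ¬ perp β v x

  Q* : SymBilinearForm → V → V → LineSet
  Q* β v e = Q β v ∖ ⟦ e ⟧

  IsLineSet : LineSet → Set
  IsLineSet A = (∀ x → A x → x ≢ 0v) × (∀ c x → c ≢ 0# → A x → A (c · x))

  record LMatroid : Set₁ where
    constructor mat
    field
      ground : LineSet
      rk     : LineSet → ℕ
  open LMatroid public

  P : QMatroid → LMatroid
  P M = mat PE (λ S → QMatroid.ρ M ⟨ S ⟩)

  _∖ₘ_ : LMatroid → LineSet → LMatroid
  M ∖ₘ A = mat (ground M ∖ A) (rk M)

  _/ₘ_ : LMatroid → LineSet → LMatroid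
  M /ₘ A = mat (ground M ∖ A) (λ X → rk M (X ∪ A) ∸ rk M A)

  IsColoop : LMatroid → V → Set
  IsColoop M w = ground M w × rk M (ground M ∖ ⟦ w ⟧) +ℕ 1 ≡ rk M (ground M)

  IsLoop : LMatroid → V → Set
  IsLoop M w = ground M w × rk M ⟦ w ⟧ ≡ 0

  HasLoop : LMatroid → Set
  HasLoop M = Σ V (IsLoop M)

  IsQColoop : (β : SymBilinearForm) → QMatroid → V → Set
  IsQColoop β M v = QMatroid.ρ M (perp β v) +ℕ 1 ≡ QMatroid.ρ M Eₚ

  DirectSumE : VPred → VPred → Set
  DirectSumE U W = (∀ x → U x → W x → x ≡ 0v) × (∀ x → (U +ₚ W) x)

{-# OPTIONS --safe #-}
-- Every line outside v⊥ together with all lines of v⊥ spans E, since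
-- x = c·u + (x − c·u) with c = B(x,v)/B(u,v) puts the second summand in v⊥.
-- Hence in (a) and (b) the relevant rank does not drop when a line outside v⊥
-- is removed (e, resp. the contracted w, remains), and in (d) the ground set
-- spans E while removing ⟨e⟩ leaves exactly the lines of v⊥.  For (c),
-- B(w₂,v)w₁ − B(w₁,v)w₂ is a nonzero vector of v⊥ spanned by w₁ and w₂, so its
-- line is a loop after contracting both.
module Submission where

open import Defs
open import Data.Nat using (ℕ)
open import Data.Product using (Σ; _×_)
open import Relation.Nullary using (¬_; Dec)
open import Relation.Binary.PropositionalEquality using (_≢_)
open import Function.Bundles using (_⇔_)

import Data.Nat as Nat
open import Data.Nat.Properties using (m+1+n≢m; n∸n≡0)
open import Data.Product using (_,_; proj₁; proj₂)
open import Data.Sum using (inj₁; inj₂)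
open import Data.Unit using (tt)
open import Data.Empty using (⊥-elim)
open import Data.Vec using (Vec; []; _∷_; zipWith; map; replicate)
open import Data.Vec.Properties
  using (≡-dec; zipWith-assoc; zipWith-comm; zipWith-identityˡ; zipWith-identityʳ;
         map-cong; map-id; map-const; map-replicate; map-∘)
open import Function.Bundles using (mk⇔)
open import Relation.Nullary using (yes; no)
open import Relation.Nullary.Decidable using (decidable-stable)
open import Relation.Binary.PropositionalEquality
  using (_≡_; refl; sym; trans; cong; cong₂; subst; module ≡-Reasoning)
open import Algebra.Structures using (IsCommutativeRing)

-- Proved for every length: the induction cannot run at the fixed dimension of Space.
module ScalarDistributivity (𝔽 : FiniteField) where
  open FiniteField 𝔽 renaming (Carrier to F)
  open IsCommutativeRing isCommutativeRing using (distribˡ; distribʳ)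

  ·-distribˡ-⊕ : ∀ {m} c (x y : Vec F m) →
                 map (c *_) (zipWith _+_ x y) ≡ zipWith _+_ (map (c *_) x) (map (c *_) y)
  ·-distribˡ-⊕ c []      []      = refl
  ·-distribˡ-⊕ c (a ∷ x) (b ∷ y) = cong₂ _∷_ (distribˡ c a b) (·-distribˡ-⊕ c x y)

  ·-distribʳ-+ : ∀ {m} c d (x : Vec F m) →
                 map ((c + d) *_) x ≡ zipWith _+_ (map (c *_) x) (map (d *_) x)
  ·-distribʳ-+ c d []      = refl
  ·-distribʳ-+ c d (a ∷ x) = cong₂ _∷_ (distribʳ a c d) (·-distribʳ-+ c d x)

module Lines (𝔽 : FiniteField) (n : ℕ) where
  open Space 𝔽 n
  open FiniteField 𝔽 renaming (Carrier to F)
  open IsCommutativeRing isCommutativeRing hiding (refl; sym; trans)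
  open ScalarDistributivity 𝔽

  _≟ᵥ_ : (x y : V) → Dec (x ≡ y)
  _≟ᵥ_ = ≡-dec _≟_

  ⊕-assoc : ∀ x y z → (x ⊕ y) ⊕ z ≡ x ⊕ (y ⊕ z)
  ⊕-assoc = zipWith-assoc +-assoc

  ⊕-comm : ∀ x y → x ⊕ y ≡ y ⊕ x
  ⊕-comm = zipWith-comm +-comm

  ⊕-identityˡ : ∀ x → 0v ⊕ x ≡ x
  ⊕-identityˡ = zipWith-identityˡ +-identityˡ

  ⊕-identityʳ : ∀ x → x ⊕ 0v ≡ x
  ⊕-identityʳ = zipWith-identityʳ +-identityʳ

  ·-identityˡ : ∀ x → 1# · x ≡ x
  ·-identityˡ x = trans (map-cong *-identityˡ x) (map-id x)

  ·-zeroˡ : ∀ x → 0# · x ≡ 0v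
  ·-zeroˡ x = trans (map-cong zeroˡ x) (map-const x 0#)

  ·-zeroʳ : ∀ c → c · 0v ≡ 0v
  ·-zeroʳ c = trans (map-replicate (c *_) 0# n) (cong (replicate n) (zeroʳ c))

  ·-assoc : ∀ c d x → (c * d) · x ≡ c · (d · x)
  ·-assoc c d x = trans (map-cong (*-assoc c d) x) (map-∘ (c *_) (d *_) x)

  ·-⊕-neg-cancel : ∀ c u x → (c · u) ⊕ (x ⊕ ((- c) · u)) ≡ x
  ·-⊕-neg-cancel c u x = begin
    (c · u) ⊕ (x ⊕ ((- c) · u))   ≡⟨ ⊕-comm (c · u) _ ⟩
    (x ⊕ ((- c) · u)) ⊕ (c · u)   ≡⟨ ⊕-assoc x _ _ ⟩
    x ⊕ (((- c) · u) ⊕ (c · u))   ≡⟨ cong (x ⊕_) (sym (·-distribʳ-+ (- c) c u)) ⟩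
    x ⊕ ((- c + c) · u)           ≡⟨ cong (λ k → x ⊕ (k · u)) (-‿inverseˡ c) ⟩
    x ⊕ (0# · u)                  ≡⟨ cong (x ⊕_) (·-zeroˡ u) ⟩
    x ⊕ 0v                        ≡⟨ ⊕-identityʳ x ⟩
    x                             ∎
    where open ≡-Reasoning

  ∈-span : ∀ {S x} → S x → SpanP S x
  ∈-span {S} {x} x∈S =
    subst (SpanP S) (trans (⊕-identityʳ (1# · x)) (·-identityˡ x)) (span-step 1# x∈S span-0)

  span-⊕ : ∀ {S x y} → SpanP S x → SpanP S y → SpanP S (x ⊕ y)
  span-⊕ {S} {y = y} span-0 y∈ = subst (SpanP S) (sym (⊕-identityˡ y)) y∈
  span-⊕ {S} {y = y} (span-step c {w} {x} w∈S x∈) y∈ =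
    subst (SpanP S) (sym (⊕-assoc (c · w) x y)) (span-step c w∈S (span-⊕ x∈ y∈))

  span-· : ∀ {S} d {x} → SpanP S x → SpanP S (d · x)
  span-· {S} d span-0 = subst (SpanP S) (sym (·-zeroʳ d)) span-0
  span-· {S} d (span-step c {w} {x} w∈S x∈) =
    subst (SpanP S) (trans (cong (_⊕ (d · x)) (·-assoc d c w)) (sym (·-distribˡ-⊕ d (c · w) x)))
      (span-step (d * c) w∈S (span-· d x∈))

  SpanP-isSubspace : ∀ S → IsSubspace (SpanP S)
  SpanP-isSubspace S = record { 0∈ = span-0 ; ⊕-closed = span-⊕ ; ·-closed = span-· }

  SpanP-least : ∀ {S U} → IsSubspace U → S ⊆ U → SpanP S ⊆ U
  SpanP-least U-sub S⊆U _ span-0 = IsSubspace.0∈ U-sub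
  SpanP-least U-sub S⊆U _ (span-step c {w} {x} w∈S x∈) =
    IsSubspace.⊕-closed U-sub (IsSubspace.·-closed U-sub c (S⊆U w w∈S)) (SpanP-least U-sub S⊆U x x∈)

  Eₚ-isSubspace : IsSubspace Eₚ
  Eₚ-isSubspace = record { 0∈ = tt ; ⊕-closed = λ _ _ → tt ; ·-closed = λ _ _ → tt }

  OnLine-refl : ∀ w → OnLine w w
  OnLine-refl w = 1# , sym (·-identityˡ w)

  OnLine-sym : ∀ {w x} → x ≢ 0v → OnLine w x → OnLine x w
  OnLine-sym {w} {x} x≢0 (c , x≡cw) with c ≟ 0#
  ... | yes c≡0 = ⊥-elim (x≢0 (trans x≡cw (trans (cong (_· w) c≡0) (·-zeroˡ w))))
  ... | no c≢0 with inverse c c≢0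
  ...   | c⁻¹ , c*c⁻¹≡1 = c⁻¹ , (begin
    w               ≡⟨ sym (·-identityˡ w) ⟩
    1# · w          ≡⟨ cong (_· w) (sym (trans (*-comm c⁻¹ c) c*c⁻¹≡1)) ⟩
    (c⁻¹ * c) · w   ≡⟨ ·-assoc c⁻¹ c w ⟩
    c⁻¹ · (c · w)   ≡⟨ cong (c⁻¹ ·_) (sym x≡cw) ⟩
    c⁻¹ · x         ∎)
    where open ≡-Reasoning

  OnLine-closed : ∀ {U w x} → IsSubspace U → U w → OnLine w x → U x
  OnLine-closed {U} U-sub w∈U (c , x≡cw) = subst U (sym x≡cw) (IsSubspace.·-closed U-sub c w∈U)

  rk-≡⇒¬IsColoop : ∀ N w → rk N (ground N ∖ ⟦ w ⟧) ≡ rk N (ground N) → ¬ IsColoop N w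
  rk-≡⇒¬IsColoop _ _ rk-≡ (_ , coloop) = m+1+n≢m _ (trans (cong (Nat._+ 1) (sym rk-≡)) coloop)

  module Orthogonal (β : SymBilinearForm) (v : V) where
    open SymBilinearForm β

    perp-isSubspace : IsSubspace (perp β v)
    perp-isSubspace = record
      { 0∈       = B0v≡0
      ; ⊕-closed = λ {x} {y} x∈ y∈ → trans (additiveˡ x y v) (trans (cong₂ _+_ x∈ y∈) (+-identityʳ 0#))
      ; ·-closed = λ c {x} x∈ → trans (homogˡ c x v) (trans (cong (c *_) x∈) (zeroʳ c))
      }
      where
      B0v≡0 : B 0v v ≡ 0#
      B0v≡0 = trans (cong (λ z → B z v) (sym (·-zeroˡ 0v))) (trans (homogˡ 0# 0v v) (zeroˡ _))

    perp? : ∀ x → Dec (perp β v x)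
    perp? x = B x v ≟ 0#

    ¬perp⇒≢0 : ∀ {w} → ¬ perp β v w → w ≢ 0v
    ¬perp⇒≢0 w∉v⊥ refl = w∉v⊥ (IsSubspace.0∈ perp-isSubspace)

    PerpLines : LineSet
    PerpLines = PE ∩ perp β v

    ⟦⟧⊆Q : ∀ {w} → ¬ perp β v w → ⟦ w ⟧ ⊆ Q β v
    ⟦⟧⊆Q w∉v⊥ y (y≢0 , y∈⟨w⟩) =
      y≢0 , λ y∈v⊥ → w∉v⊥ (OnLine-closed perp-isSubspace y∈v⊥ (OnLine-sym y≢0 y∈⟨w⟩))

    PerpLines⊆∖ : ∀ {S A} → PerpLines ⊆ S → A ⊆ Q β v → PerpLines ⊆ (S ∖ A)
    PerpLines⊆∖ S⊇ A⊆Q y y∈ = S⊇ y y∈ , λ y∈A → proj₂ (A⊆Q y y∈A) (proj₂ y∈)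

    PerpLines⊆PE∖ : ∀ {A} → A ⊆ Q β v → PerpLines ⊆ (PE ∖ A)
    PerpLines⊆PE∖ = PerpLines⊆∖ (λ _ → proj₁)

    perp⊆span : ∀ {S} → PerpLines ⊆ S → perp β v ⊆ ⟨ S ⟩
    perp⊆span S⊇ x x∈v⊥ with x ≟ᵥ 0v
    ... | yes refl = span-0
    ... | no x≢0   = ∈-span (S⊇ x (x≢0 , x∈v⊥))

    module Projection {u : V} (u∉v⊥ : ¬ perp β v u) where
      private
        b⁻¹ : F
        b⁻¹ = proj₁ (inverse (B u v) u∉v⊥)

        b*b⁻¹≡1 : B u v * b⁻¹ ≡ 1#
        b*b⁻¹≡1 = proj₂ (inverse (B u v) u∉v⊥)

      coeff : V → F
      coeff x = B x v * b⁻¹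

      project : V → V
      project x = x ⊕ ((- coeff x) · u)

      coeff-scales : ∀ x → coeff x * B u v ≡ B x v
      coeff-scales x = begin
        (B x v * b⁻¹) * B u v   ≡⟨ *-assoc (B x v) b⁻¹ (B u v) ⟩
        B x v * (b⁻¹ * B u v)   ≡⟨ cong (B x v *_) (trans (*-comm b⁻¹ (B u v)) b*b⁻¹≡1) ⟩
        B x v * 1#              ≡⟨ *-identityʳ (B x v) ⟩
        B x v                   ∎
        where open ≡-Reasoning

      project-perp : ∀ x → perp β v (project x)
      project-perp x = begin
        B (x ⊕ ((- c) · u)) v               ≡⟨ additiveˡ x ((- c) · u) v ⟩
        B x v + B ((- c) · u) v             ≡⟨ cong (B x v +_) (homogˡ (- c) u v) ⟩
        B x v + (- c) * B u v               ≡⟨ cong (_+ (- c) * B u v) (sym (coeff-scales x)) ⟩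
        c * B u v + (- c) * B u v           ≡⟨ sym (distribʳ (B u v) c (- c)) ⟩
        (c + - c) * B u v                   ≡⟨ cong (_* B u v) (-‿inverseʳ c) ⟩
        0# * B u v                          ≡⟨ zeroˡ (B u v) ⟩
        0#                                  ∎
        where
        open ≡-Reasoning
        c = coeff x

      coeff-·-⊕-project : ∀ x → (coeff x · u) ⊕ project x ≡ x
      coeff-·-⊕-project x = ·-⊕-neg-cancel (coeff x) u x

    span-full : ∀ {S u} → PerpLines ⊆ S → S u → ¬ perp β v u → ∀ x → ⟨ S ⟩ x
    span-full {S} S⊇ u∈S u∉v⊥ x =
      subst ⟨ S ⟩ (coeff-·-⊕-project x) (span-step (coeff x) u∈S (perp⊆span S⊇ _ (project-perp x)))
      where open Projection u∉v⊥

    module _ (M : QMatroid) where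
      open QMatroid M

      ρ-span-full : ∀ {S u} → PerpLines ⊆ S → S u → ¬ perp β v u → ρ ⟨ S ⟩ ≡ ρ Eₚ
      ρ-span-full {S} S⊇ u∈S u∉v⊥ =
        ρ-cong ⟨ S ⟩ Eₚ (SpanP-isSubspace S) Eₚ-isSubspace (λ _ _ → tt) (λ x _ → span-full S⊇ u∈S u∉v⊥ x)

      ρ-⟨⟦⟧∪⟩ : ∀ {T x} → ⟨ T ⟩ x → ρ ⟨ ⟦ x ⟧ ∪ T ⟩ ≡ ρ ⟨ T ⟩
      ρ-⟨⟦⟧∪⟩ {T} x∈⟨T⟩ =
        ρ-cong _ _ (SpanP-isSubspace _) (SpanP-isSubspace T)
          (SpanP-least (SpanP-isSubspace T) ⟦x⟧∪T⊆⟨T⟩)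
          (SpanP-least (SpanP-isSubspace _) (λ y y∈T → ∈-span (inj₂ y∈T)))
        where
        ⟦x⟧∪T⊆⟨T⟩ : (⟦ _ ⟧ ∪ T) ⊆ ⟨ T ⟩
        ⟦x⟧∪T⊆⟨T⟩ y (inj₁ (_ , y∈⟨x⟩)) = OnLine-closed (SpanP-isSubspace T) x∈⟨T⟩ y∈⟨x⟩
        ⟦x⟧∪T⊆⟨T⟩ y (inj₂ y∈T)          = ∈-span y∈T

      deletion-¬IsColoop : ∀ {A w u} → A ⊆ Q β v → ¬ perp β v w →
                           ((PE ∖ A) ∖ ⟦ w ⟧) u → ¬ perp β v u → ¬ IsColoop (P M ∖ₘ A) w
      deletion-¬IsColoop {A} {w} A⊆Q w∉v⊥ u∈ u∉v⊥ = rk-≡⇒¬IsColoop (P M ∖ₘ A) w (trans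
        (ρ-span-full (PerpLines⊆∖ (PerpLines⊆PE∖ A⊆Q) (⟦⟧⊆Q w∉v⊥)) u∈ u∉v⊥)
        (sym (ρ-span-full (PerpLines⊆PE∖ A⊆Q) (proj₁ u∈) u∉v⊥)))

      contraction-¬IsColoop : ∀ {A w z} → A ⊆ Q β v → ¬ perp β v w → ¬ perp β v z →
                              ¬ IsColoop ((P M ∖ₘ A) /ₘ ⟦ w ⟧) z
      contraction-¬IsColoop {A} {w} {z} A⊆Q w∉v⊥ z∉v⊥ =
        rk-≡⇒¬IsColoop ((P M ∖ₘ A) /ₘ ⟦ w ⟧) z (cong (Nat._∸ ρ ⟨ ⟦ w ⟧ ⟩)
        (trans (ρ-full (PerpLines⊆∖ ground⊇ (⟦⟧⊆Q z∉v⊥))) (sym (ρ-full ground⊇))))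
        where
        ground⊇ : PerpLines ⊆ ((PE ∖ A) ∖ ⟦ w ⟧)
        ground⊇ = PerpLines⊆∖ (PerpLines⊆PE∖ A⊆Q) (⟦⟧⊆Q w∉v⊥)
        ρ-full : ∀ {S} → PerpLines ⊆ S → ρ ⟨ S ∪ ⟦ w ⟧ ⟩ ≡ ρ Eₚ
        ρ-full S⊇ = ρ-span-full (λ y y∈ → inj₁ (S⊇ y y∈)) (inj₂ (¬perp⇒≢0 w∉v⊥ , OnLine-refl w)) w∉v⊥

      perp-∈-span-IsLoop : ∀ {A T x} → A ⊆ Q β v → T ⊆ Q β v → PerpLines x → ⟨ T ⟩ x →
                           IsLoop ((P M ∖ₘ A) /ₘ T) x
      perp-∈-span-IsLoop {T = T} A⊆Q T⊆Q x∈ x∈⟨T⟩ =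
        PerpLines⊆∖ (PerpLines⊆PE∖ A⊆Q) T⊆Q _ x∈ ,
        trans (cong (Nat._∸ ρ ⟨ T ⟩) (ρ-⟨⟦⟧∪⟩ x∈⟨T⟩)) (n∸n≡0 (ρ ⟨ T ⟩))

      contraction-HasLoop : ∀ {A w₁ w₂} → A ⊆ Q β v → ¬ perp β v w₁ → ¬ perp β v w₂ →
                            ¬ SameLine w₁ w₂ → HasLoop ((P M ∖ₘ A) /ₘ (⟦ w₁ ⟧ ∪ ⟦ w₂ ⟧))
      contraction-HasLoop {A} {w₁} {w₂} A⊆Q w₁∉v⊥ w₂∉v⊥ w₁≁w₂ =
        project w₂ , perp-∈-span-IsLoop A⊆Q T⊆Q (x≢0 , project-perp w₂) x∈⟨T⟩
        where
        open Projection w₁∉v⊥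
        T = ⟦ w₁ ⟧ ∪ ⟦ w₂ ⟧
        T⊆Q : T ⊆ Q β v
        T⊆Q y (inj₁ y∈) = ⟦⟧⊆Q w₁∉v⊥ y y∈
        T⊆Q y (inj₂ y∈) = ⟦⟧⊆Q w₂∉v⊥ y y∈
        x≢0 : project w₂ ≢ 0v
        x≢0 x≡0 = w₁≁w₂ (coeff w₂ , (begin
          w₂                                ≡⟨ sym (coeff-·-⊕-project w₂) ⟩
          (coeff w₂ · w₁) ⊕ project w₂      ≡⟨ cong ((coeff w₂ · w₁) ⊕_) x≡0 ⟩
          (coeff w₂ · w₁) ⊕ 0v              ≡⟨ ⊕-identityʳ _ ⟩
          coeff w₂ · w₁                     ∎))
          where open ≡-Reasoning
        x∈⟨T⟩ : ⟨ T ⟩ (project w₂)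
        x∈⟨T⟩ = span-⊕ (∈-span (inj₂ (¬perp⇒≢0 w₂∉v⊥ , OnLine-refl w₂)))
                       (span-· (- coeff w₂) (∈-span (inj₁ (¬perp⇒≢0 w₁∉v⊥ , OnLine-refl w₁))))

      deletion-IsColoop⇔IsQColoop : ∀ {e} → ¬ perp β v e →
                                    IsColoop (P M ∖ₘ Q* β v e) e ⇔ IsQColoop β M v
      deletion-IsColoop⇔IsQColoop {e} e∉v⊥ = mk⇔
        (λ (_ , coloop) → trans (cong (Nat._+ 1) (sym ρ⟨G∖e⟩≡ρv⊥)) (trans coloop ρ⟨G⟩≡ρE))
        (λ qcoloop → e∈G , trans (cong (Nat._+ 1) ρ⟨G∖e⟩≡ρv⊥) (trans qcoloop (sym ρ⟨G⟩≡ρE)))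
        where
        G : LineSet
        G = PE ∖ Q* β v e
        e∈G : G e
        e∈G = ¬perp⇒≢0 e∉v⊥ , λ (_ , e∉⟦e⟧) → e∉⟦e⟧ (¬perp⇒≢0 e∉v⊥ , OnLine-refl e)
        G⊇ : PerpLines ⊆ G
        G⊇ = PerpLines⊆PE∖ (λ _ → proj₁)
        G∖e⊆v⊥ : (G ∖ ⟦ e ⟧) ⊆ perp β v
        G∖e⊆v⊥ y ((y≢0 , y∉Q*) , y∉⟦e⟧) =
          decidable-stable (perp? y) (λ y∉v⊥ → y∉Q* ((y≢0 , y∉v⊥) , y∉⟦e⟧))
        ρ⟨G⟩≡ρE : ρ ⟨ G ⟩ ≡ ρ Eₚ
        ρ⟨G⟩≡ρE = ρ-span-full G⊇ e∈G e∉v⊥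
        ρ⟨G∖e⟩≡ρv⊥ : ρ ⟨ G ∖ ⟦ e ⟧ ⟩ ≡ ρ (perp β v)
        ρ⟨G∖e⟩≡ρv⊥ = ρ-cong _ _ (SpanP-isSubspace _) perp-isSubspace
          (SpanP-least perp-isSubspace G∖e⊆v⊥) (perp⊆span (PerpLines⊆∖ G⊇ (⟦⟧⊆Q e∉v⊥)))

lemma5p12 : (𝔽 : FiniteField) (n : ℕ) →
    let open Space 𝔽 n in
    (M : QMatroid) (β : SymBilinearForm) (e v : V) →
    e ≢ 0v → v ≢ 0v →
    DirectSumE (OnLine e) (perp β v) →
    ((A : LineSet) → IsLineSet A → (∀ x → Dec (A x)) →
       A ⊆ Q* β v e → Σ V (λ x → Q* β v e x × ¬ A x) →
       -- (a)
       (∀ w → (Q* β v e ∖ A) w → ¬ IsColoop (P M ∖ₘ A) w)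
       -- (b)
       × (∀ w → (Q* β v e ∖ A) w → ∀ z → (Q β v ∖ (A ∪ ⟦ w ⟧)) z →
            ¬ IsColoop ((P M ∖ₘ A) /ₘ ⟦ w ⟧) z)
       -- (c)
       × (∀ w₁ w₂ → (Q β v ∖ A) w₁ → (Q β v ∖ A) w₂ → ¬ SameLine w₁ w₂ →
            HasLoop ((P M ∖ₘ A) /ₘ (⟦ w₁ ⟧ ∪ ⟦ w₂ ⟧))))
    -- (d)
    × (IsColoop (P M ∖ₘ Q* β v e) e ⇔ IsQColoop β M v)
lemma5p12 𝔽 n M β e v e≢0 _ (e⊥-trivial , _) =
  (λ A _ _ A⊆Q* _ →
      (λ { w (((w≢0 , w∉v⊥) , w∉⟦e⟧) , _) →
             deletion-¬IsColoop M (Q*-⊆-Q A⊆Q*) w∉v⊥ (e∈ground A⊆Q* w≢0 w∉⟦e⟧) e∉v⊥ })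
    , (λ { w (((_ , w∉v⊥) , _) , _) z ((_ , z∉v⊥) , _) →
             contraction-¬IsColoop M (Q*-⊆-Q A⊆Q*) w∉v⊥ z∉v⊥ })
    , (λ { w₁ w₂ ((_ , w₁∉v⊥) , _) ((_ , w₂∉v⊥) , _) →
             contraction-HasLoop M (Q*-⊆-Q A⊆Q*) w₁∉v⊥ w₂∉v⊥ }))
  , deletion-IsColoop⇔IsQColoop M e∉v⊥
  where
  open Space 𝔽 n
  open Lines 𝔽 n
  open Orthogonal β v

  e∉v⊥ : ¬ perp β v e
  e∉v⊥ e∈v⊥ = e≢0 (e⊥-trivial e (OnLine-refl e) e∈v⊥)

  Q*-⊆-Q : ∀ {A} → A ⊆ Q* β v e → A ⊆ Q β v
  Q*-⊆-Q A⊆Q* x x∈A = proj₁ (A⊆Q* x x∈A)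

  e∈ground : ∀ {A w} → A ⊆ Q* β v e → w ≢ 0v → ¬ ⟦ e ⟧ w → ((PE ∖ A) ∖ ⟦ w ⟧) e
  e∈ground A⊆Q* w≢0 w∉⟦e⟧ =
    (e≢0 , λ e∈A → proj₂ (A⊆Q* e e∈A) (e≢0 , OnLine-refl e)) ,
    λ (_ , e∈⟨w⟩) → w∉⟦e⟧ (w≢0 , OnLine-sym e≢0 e∈⟨w⟩)
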